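{- If $M\in H$ has entry $M_{23}=0$ (row $2$, column $3$), then $M=I$, or $M=J$, or $M=B^n$ for some $n\in\mathbb{Z}$, or $M=JB^n$ for some $n\in\mathbb{Z}$.
   Context: $B=\begin{pmatrix}3&4&0\\2&3&0\\0&0&1\end{pmatrix}$, $J=\begin{pmatrix}0&0&1\\0&1&0\\1&0&0\end{pmatrix}$, $I$ is the $3\times3$ identity matrix, and $H$ is the subgroup of $\mathrm{GL}_3(\mathbb{Z})$ generated by $B$ and $J$. -}

module Defs where

open import Data.Integer using (ℤ; +_; -[1+_]; _+_; _*_; -_)
open import Data.Nat using (ℕ; zero; suc)
open import Data.Fin using (Fin; zero; suc)
open import Relation.Binary.PropositionalEquality using (_≡_)

-- 3×3 integer matrices, stored as 9 entries (row-major), so that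
-- matrix equality is propositional equality.
record Mat3 : Set where
  constructor mat
  field
    a11 a12 a13 a21 a22 a23 a31 a32 a33 : ℤ
open Mat3 public

-- entry (i , j), indices 0-based via Fin 3 (so row 2 = suc zero)
entry : Mat3 → Fin 3 → Fin 3 → ℤ
entry m zero zero = a11 m
entry m zero (suc zero) = a12 m
entry m zero (suc (suc zero)) = a13 m
entry m (suc zero) zero = a21 m
entry m (suc zero) (suc zero) = a22 m
entry m (suc zero) (suc (suc zero)) = a23 m
entry m (suc (suc zero)) zero = a31 m
entry m (suc (suc zero)) (suc zero) = a32 m
entry m (suc (suc zero)) (suc (suc zero)) = a33 m

_·_ : Mat3 → Mat3 → Mat3
x · y = mat
  (a11 x * a11 y + a12 x * a21 y + a13 x * a31 y)
  (a11 x * a12 y + a12 x * a22 y + a13 x * a32 y)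
  (a11 x * a13 y + a12 x * a23 y + a13 x * a33 y)
  (a21 x * a11 y + a22 x * a21 y + a23 x * a31 y)
  (a21 x * a12 y + a22 x * a22 y + a23 x * a32 y)
  (a21 x * a13 y + a22 x * a23 y + a23 x * a33 y)
  (a31 x * a11 y + a32 x * a21 y + a33 x * a31 y)
  (a31 x * a12 y + a32 x * a22 y + a33 x * a32 y)
  (a31 x * a13 y + a32 x * a23 y + a33 x * a33 y)
infixl 7 _·_

I : Mat3
I = mat (+ 1) (+ 0) (+ 0) (+ 0) (+ 1) (+ 0) (+ 0) (+ 0) (+ 1)

B : Mat3
B = mat (+ 3) (+ 4) (+ 0) (+ 2) (+ 3) (+ 0) (+ 0) (+ 0) (+ 1)

B⁻¹ : Mat3
B⁻¹ = mat (+ 3) (- (+ 4)) (+ 0) (- (+ 2)) (+ 3) (+ 0) (+ 0) (+ 0) (+ 1)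

J : Mat3
J = mat (+ 0) (+ 0) (+ 1) (+ 0) (+ 1) (+ 0) (+ 1) (+ 0) (+ 0)

_^_ : Mat3 → ℕ → Mat3
m ^ zero = I
m ^ suc n = m · (m ^ n)

Bpow : ℤ → Mat3
Bpow (+ n) = B ^ n
Bpow -[1+ n ] = B⁻¹ ^ suc n

-- H = subgroup of GL₃(ℤ) generated by B and J: the smallest set
-- containing I, B, B⁻¹, J (= J⁻¹) and closed under products.
-- (Closure under inverses follows since generator inverses are included.)
data InH : Mat3 → Set where
  h-I   : InH I
  h-B   : InH B
  h-B⁻¹ : InH B⁻¹
  h-J   : InH J
  h-mul : ∀ {x y} → InH x → InH y → InH (x · y)

module Submission where

open import Defs
open import Data.Integer using (ℤ; +_)
open import Data.Fin using (zero; suc)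
open import Data.Sum using (_⊎_)
open import Data.Product using (∃-syntax)
open import Relation.Binary.PropositionalEquality using (_≡_)

open import Data.Integer using (0ℤ; +[1+_]; -[1+_]; _+_; _*_; _-_; -_)
open import Data.Integer.Properties using (pos-*; *-zeroʳ)
open import Data.Integer.Tactic.RingSolver using (solve-∀)
open import Data.Nat as ℕ using (suc)
open import Data.Sum using (inj₁; inj₂)
open import Data.Product using (_,_)
open import Data.Empty using (⊥-elim)
open import Relation.Nullary using (¬_)
open import Relation.Binary.PropositionalEquality
  using (_≢_; refl; sym; trans; cong; subst)

-- Proof idea (ping-pong on the third column).  Every element of H is a
-- power Bⁿ or a reduced word in which nonzero powers of B alternate with
-- J; we classify reduced words by their leftmost letter (B, B⁻¹ or J) and
-- show that this normal form is closed under left multiplication by the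
-- generators, hence covers H.  Next we follow the third column
-- v = (x, y, z) of a word, on which the generators act by matrix-vector
-- multiplication.  All of H preserves Q(v) = x² − 2y² + z², and on the
-- quadric Q = 1 three regions play ping-pong:
--   Region⁺ : xy > 0, y² > z²     (B maps it into itself)
--   Region⁻ : xy < 0, y² > z²     (B⁻¹ maps it into itself)
--   RegionJ : y² > x²             (B, B⁻¹ map it into Region⁺, Region⁻)
-- and J maps Region⁺ and Region⁻ into RegionJ.  The word J·Bᵐ has column e₁, and
-- B, B⁻¹ send e₁ into Region⁺, Region⁻.  So every reduced word other than
-- Bⁿ and J·Bⁿ has its column in one of the regions, all of which avoid
-- the plane y = 0; the theorem follows.

-- Positivity and nonnegativity of integers, carried as witnesses so that
-- sums and scalings by literals are checked by computation.  Every sign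
-- condition below is obtained from these closure rules after rewriting
-- the quantity by a polynomial identity.

Pos NonNeg : ℤ → Set
Pos a = ∃[ n ] a ≡ +[1+ n ]
NonNeg a = ∃[ n ] a ≡ + n

pos⇒nonNeg : ∀ {a} → Pos a → NonNeg a
pos⇒nonNeg (n , eq) = suc n , eq

¬pos-0 : ¬ Pos 0ℤ
¬pos-0 (_ , ())

¬pos-neg : ∀ {a} → NonNeg a → ¬ Pos (0ℤ - a)
¬pos-neg (ℕ.zero , refl) (_ , ())
¬pos-neg (suc n , refl) (_ , ())

+-pos-nonNeg : ∀ {a b} → Pos a → NonNeg b → Pos (a + b)
+-pos-nonNeg (m , refl) (n , refl) = m ℕ.+ n , refl

+-nonNeg : ∀ {a b} → NonNeg a → NonNeg b → NonNeg (a + b)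
+-nonNeg (m , refl) (n , refl) = m ℕ.+ n , refl

*-pos : ∀ k .{{_ : ℕ.NonZero k}} {a} → Pos a → Pos (+ k * a)
*-pos (suc k) (n , refl) = n ℕ.+ k ℕ.* suc n , refl

*-nonNeg : ∀ k {a} → NonNeg a → NonNeg (+ k * a)
*-nonNeg k (n , refl) = k ℕ.* n , sym (pos-* k n)

square-nonNeg : ∀ a → NonNeg (a * a)
square-nonNeg (+ n) = n ℕ.* n , sym (pos-* n n)
square-nonNeg -[1+ n ] = suc n ℕ.* suc n , refl

square-pos : ∀ {a} → a ≢ 0ℤ → Pos (a * a)
square-pos {+ ℕ.zero} a≢0 = ⊥-elim (a≢0 refl)
square-pos {+[1+ n ]} _ = n ℕ.+ n ℕ.* suc n , refl
square-pos { -[1+ n ]} _ = n ℕ.+ n ℕ.* suc n , refl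

pos-pred : ∀ {a} → Pos a → NonNeg (a - + 1)
pos-pred (n , refl) = n , refl

-- used when only 2·t is exhibited as a positive combination
half-pos : ∀ t → Pos (t + t) → Pos t
half-pos (+ ℕ.zero) (_ , ())
half-pos +[1+ m ] _ = m , refl
half-pos -[1+ m ] (_ , ())

dominant-square≢0 : ∀ y w → Pos (y * y - w * w) → y ≢ 0ℤ
dominant-square≢0 y w d refl = ¬pos-neg (square-nonNeg w) d

pos-product⇒≢0 : ∀ a b → Pos (a * b) → b ≢ 0ℤ
pos-product⇒≢0 a b ab>0 refl = ¬pos-0 (subst Pos (*-zeroʳ a) ab>0)

mat-cong : ∀ {a1 a2 a3 a4 a5 a6 a7 a8 a9 b1 b2 b3 b4 b5 b6 b7 b8 b9 : ℤ} →
  a1 ≡ b1 → a2 ≡ b2 → a3 ≡ b3 → a4 ≡ b4 → a5 ≡ b5 → a6 ≡ b6 →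
  a7 ≡ b7 → a8 ≡ b8 → a9 ≡ b9 →
  mat a1 a2 a3 a4 a5 a6 a7 a8 a9 ≡ mat b1 b2 b3 b4 b5 b6 b7 b8 b9
mat-cong refl refl refl refl refl refl refl refl refl = refl

-- one entry of (x·y)·z versus x·(y·z), for the middle factor y = (bᵢⱼ),
-- a row (a1 a2 a3) of x and a column (c1 c2 c3) of z
assoc-entry : ∀ b11 b12 b13 b21 b22 b23 b31 b32 b33 a1 a2 a3 c1 c2 c3 →
  (a1 * b11 + a2 * b21 + a3 * b31) * c1 + (a1 * b12 + a2 * b22 + a3 * b32) * c2
    + (a1 * b13 + a2 * b23 + a3 * b33) * c3
  ≡ a1 * (b11 * c1 + b12 * c2 + b13 * c3) + a2 * (b21 * c1 + b22 * c2 + b23 * c3)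
    + a3 * (b31 * c1 + b32 * c2 + b33 * c3)
assoc-entry = solve-∀

·-assoc : ∀ x y z → (x · y) · z ≡ x · (y · z)
·-assoc (mat x1 x2 x3 x4 x5 x6 x7 x8 x9) (mat y1 y2 y3 y4 y5 y6 y7 y8 y9)
        (mat z1 z2 z3 z4 z5 z6 z7 z8 z9) =
  let at = assoc-entry y1 y2 y3 y4 y5 y6 y7 y8 y9 in
  mat-cong (at x1 x2 x3 z1 z4 z7) (at x1 x2 x3 z2 z5 z8) (at x1 x2 x3 z3 z6 z9)
           (at x4 x5 x6 z1 z4 z7) (at x4 x5 x6 z2 z5 z8) (at x4 x5 x6 z3 z6 z9)
           (at x7 x8 x9 z1 z4 z7) (at x7 x8 x9 z2 z5 z8) (at x7 x8 x9 z3 z6 z9)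

unit₁ : ∀ a b c → + 1 * a + + 0 * b + + 0 * c ≡ a
unit₁ = solve-∀

unit₂ : ∀ a b c → + 0 * a + + 1 * b + + 0 * c ≡ b
unit₂ = solve-∀

unit₃ : ∀ a b c → + 0 * a + + 0 * b + + 1 * c ≡ c
unit₃ = solve-∀

·-identityˡ : ∀ m → I · m ≡ m
·-identityˡ (mat a b c d e f g h i) =
  mat-cong (unit₁ a d g) (unit₁ b e h) (unit₁ c f i)
           (unit₂ a d g) (unit₂ b e h) (unit₂ c f i)
           (unit₃ a d g) (unit₃ b e h) (unit₃ c f i)

cancelˡ : ∀ g h N → g · h ≡ I → g · (h · N) ≡ N
cancelˡ g h N gh≡I = trans (sym (·-assoc g h N)) (trans (cong (_· N) gh≡I) (·-identityˡ N))

B-cancels : ∀ N → B · (B⁻¹ · N) ≡ N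
B-cancels N = cancelˡ B B⁻¹ N refl

B⁻¹-cancels : ∀ N → B⁻¹ · (B · N) ≡ N
B⁻¹-cancels N = cancelˡ B⁻¹ B N refl

J-cancels : ∀ N → J · (J · N) ≡ N
J-cancels N = cancelˡ J J N refl

-- A reduced word is classified by its leftmost letter;
-- each constructor prepends one generator, and a word never contains
-- B·B⁻¹, B⁻¹·B or J·J.  The words Bⁿ and J·Bⁿ, whose third column is
-- e₃ resp. e₁, are the exceptional normal forms of the theorem.

data JWord : Mat3 → Set
data BWord : Mat3 → Set
data B⁻¹Word : Mat3 → Set

data JWord where
  J-B   : ∀ {N} → BWord N → JWord (J · N)
  J-B⁻¹ : ∀ {N} → B⁻¹Word N → JWord (J · N)

data BWord where
  B-Jpow : ∀ n → BWord (B · (J · Bpow n))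
  B-J    : ∀ {N} → JWord N → BWord (B · N)
  B-B    : ∀ {N} → BWord N → BWord (B · N)

data B⁻¹Word where
  B⁻¹-Jpow : ∀ n → B⁻¹Word (B⁻¹ · (J · Bpow n))
  B⁻¹-J    : ∀ {N} → JWord N → B⁻¹Word (B⁻¹ · N)
  B⁻¹-B⁻¹  : ∀ {N} → B⁻¹Word N → B⁻¹Word (B⁻¹ · N)

data NormalForm : Mat3 → Set where
  power    : ∀ n → NormalForm (Bpow n)
  J-power  : ∀ n → NormalForm (J · Bpow n)
  j-word   : ∀ {M} → JWord M → NormalForm M
  b-word   : ∀ {M} → BWord M → NormalForm M
  b⁻¹-word : ∀ {M} → B⁻¹Word M → NormalForm M

-- Left multiplication by each generator preserves normal forms:
-- either a letter is prepended or it cancels against the leftmost one.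

B-closed : ∀ {N} → NormalForm N → NormalForm (B · N)
B-closed (power (+ k)) = power (+ suc k)
B-closed (power -[1+ ℕ.zero ]) = subst NormalForm (sym (B-cancels I)) (power (+ 0))
B-closed (power -[1+ suc k ]) = subst NormalForm (sym (B-cancels _)) (power -[1+ k ])
B-closed (J-power n) = b-word (B-Jpow n)
B-closed (j-word w) = b-word (B-J w)
B-closed (b-word w) = b-word (B-B w)
B-closed (b⁻¹-word (B⁻¹-Jpow n)) = subst NormalForm (sym (B-cancels _)) (J-power n)
B-closed (b⁻¹-word (B⁻¹-J w)) = subst NormalForm (sym (B-cancels _)) (j-word w)
B-closed (b⁻¹-word (B⁻¹-B⁻¹ w)) = subst NormalForm (sym (B-cancels _)) (b⁻¹-word w)

B⁻¹-closed : ∀ {N} → NormalForm N → NormalForm (B⁻¹ · N)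
B⁻¹-closed (power (+ ℕ.zero)) = power -[1+ 0 ]
B⁻¹-closed (power (+ suc k)) = subst NormalForm (sym (B⁻¹-cancels _)) (power (+ k))
B⁻¹-closed (power -[1+ k ]) = power -[1+ suc k ]
B⁻¹-closed (J-power n) = b⁻¹-word (B⁻¹-Jpow n)
B⁻¹-closed (j-word w) = b⁻¹-word (B⁻¹-J w)
B⁻¹-closed (b-word (B-Jpow n)) = subst NormalForm (sym (B⁻¹-cancels _)) (J-power n)
B⁻¹-closed (b-word (B-J w)) = subst NormalForm (sym (B⁻¹-cancels _)) (j-word w)
B⁻¹-closed (b-word (B-B w)) = subst NormalForm (sym (B⁻¹-cancels _)) (b-word w)
B⁻¹-closed (b⁻¹-word w) = b⁻¹-word (B⁻¹-B⁻¹ w)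

J-closed : ∀ {N} → NormalForm N → NormalForm (J · N)
J-closed (power n) = J-power n
J-closed (J-power n) = subst NormalForm (sym (J-cancels _)) (power n)
J-closed (j-word (J-B w)) = subst NormalForm (sym (J-cancels _)) (b-word w)
J-closed (j-word (J-B⁻¹ w)) = subst NormalForm (sym (J-cancels _)) (b⁻¹-word w)
J-closed (b-word w) = j-word (J-B w)
J-closed (b⁻¹-word w) = j-word (J-B⁻¹ w)

H-closed : ∀ {M N} → InH M → NormalForm N → NormalForm (M · N)
H-closed {N = N} h-I nf = subst NormalForm (sym (·-identityˡ N)) nf
H-closed h-B nf = B-closed nf
H-closed h-B⁻¹ nf = B⁻¹-closed nf
H-closed h-J nf = J-closed nf
H-closed {N = N} (h-mul {x} {y} hx hy) nf =
  subst NormalForm (sym (·-assoc x y N)) (H-closed hx (H-closed hy nf))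

normal-form : ∀ {M} → InH M → NormalForm M
normal-form h-I = power (+ 0)
normal-form h-B = power (+ 1)
normal-form h-B⁻¹ = power -[1+ 0 ]
normal-form h-J = J-power (+ 0)
normal-form (h-mul hx hy) = H-closed hx (normal-form hy)

record V3 : Set where
  constructor vec
  field
    x y z : ℤ

column : Mat3 → V3
column m = vec (a13 m) (a23 m) (a33 m)

-- matrix-vector product; column (g · N) is definitionally g ▸ column N
_▸_ : Mat3 → V3 → V3
g ▸ vec x y z = vec (a11 g * x + a12 g * y + a13 g * z)
                    (a21 g * x + a22 g * y + a23 g * z)
                    (a31 g * x + a32 g * y + a33 g * z)
infixr 6 _▸_

e₁ e₃ : V3
e₁ = vec (+ 1) (+ 0) (+ 0)
e₃ = vec (+ 0) (+ 0) (+ 1)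

vec-cong : ∀ {x y z x′ y′ z′} → x ≡ x′ → y ≡ y′ → z ≡ z′ → vec x y z ≡ vec x′ y′ z′
vec-cong refl refl refl = refl

column-pow : ∀ g → g ▸ e₃ ≡ e₃ → ∀ k → column (g ^ k) ≡ e₃
column-pow g fix ℕ.zero = refl
column-pow g fix (suc k) = trans (cong (g ▸_) (column-pow g fix k)) fix

column-Bpow : ∀ n → column (Bpow n) ≡ e₃
column-Bpow (+ k) = column-pow B refl k
column-Bpow -[1+ k ] = column-pow B⁻¹ refl (suc k)

column-J-Bpow : ∀ n → column (J · Bpow n) ≡ e₁
column-J-Bpow n = cong (J ▸_) (column-Bpow n)

-- B acts as the Pell unit 3 + 2√2 on (x, y) and fixes z
B-acts : ∀ x y z → B ▸ vec x y z ≡ vec (+ 3 * x + + 4 * y) (+ 2 * x + + 3 * y) z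
B-acts x y z = vec-cong (first x y z) (second x y z) (unit₃ x y z)
  where
  first : ∀ x y z → + 3 * x + + 4 * y + + 0 * z ≡ + 3 * x + + 4 * y
  first = solve-∀
  second : ∀ x y z → + 2 * x + + 3 * y + + 0 * z ≡ + 2 * x + + 3 * y
  second = solve-∀

B⁻¹-acts : ∀ x y z → B⁻¹ ▸ vec x y z ≡ vec (+ 3 * x - + 4 * y) (+ 3 * y - + 2 * x) z
B⁻¹-acts x y z = vec-cong (first x y z) (second x y z) (unit₃ x y z)
  where
  first : ∀ x y z → + 3 * x + - (+ 4) * y + + 0 * z ≡ + 3 * x - + 4 * y
  first = solve-∀
  second : ∀ x y z → - (+ 2) * x + + 3 * y + + 0 * z ≡ + 3 * y - + 2 * x
  second = solve-∀

J-acts : ∀ x y z → J ▸ vec x y z ≡ vec z y x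
J-acts x y z = vec-cong (unit₃ x y z) (unit₂ x y z) (unit₁ x y z)

Q : ℤ → ℤ → ℤ → ℤ
Q x y z = x * x - + 2 * (y * y) + z * z

data Region⁺ : V3 → Set where
  region⁺ : ∀ {x y z} → Q x y z ≡ + 1 → Pos (x * y) → Pos (y * y - z * z) →
    Region⁺ (vec x y z)

data Region⁻ : V3 → Set where
  region⁻ : ∀ {x y z} → Q x y z ≡ + 1 → Pos (- (x * y)) → Pos (y * y - z * z) →
    Region⁻ (vec x y z)

data RegionJ : V3 → Set where
  regionJ : ∀ {x y z} → Q x y z ≡ + 1 → Pos (y * y - x * x) → RegionJ (vec x y z)

Region⁺-y≢0 : ∀ {v} → Region⁺ v → V3.y v ≢ 0ℤ
Region⁺-y≢0 (region⁺ {y = y} {z} _ _ y²>z²) = dominant-square≢0 y z y²>z²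

Region⁻-y≢0 : ∀ {v} → Region⁻ v → V3.y v ≢ 0ℤ
Region⁻-y≢0 (region⁻ {y = y} {z} _ _ y²>z²) = dominant-square≢0 y z y²>z²

RegionJ-y≢0 : ∀ {v} → RegionJ v → V3.y v ≢ 0ℤ
RegionJ-y≢0 (regionJ {x} {y} _ y²>x²) = dominant-square≢0 y x y²>x²

Q-B-invariant : ∀ x y z → Q (+ 3 * x + + 4 * y) (+ 2 * x + + 3 * y) z ≡ Q x y z
Q-B-invariant = identity
  where
  identity : ∀ x y z → let x′ = + 3 * x + + 4 * y ; y′ = + 2 * x + + 3 * y in
    x′ * x′ - + 2 * (y′ * y′) + z * z ≡ x * x - + 2 * (y * y) + z * z
  identity = solve-∀

Q-B⁻¹-invariant : ∀ x y z → Q (+ 3 * x - + 4 * y) (+ 3 * y - + 2 * x) z ≡ Q x y z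
Q-B⁻¹-invariant = identity
  where
  identity : ∀ x y z → let x′ = + 3 * x - + 4 * y ; y′ = + 3 * y - + 2 * x in
    x′ * x′ - + 2 * (y′ * y′) + z * z ≡ x * x - + 2 * (y * y) + z * z
  identity = solve-∀

Q-J-invariant : ∀ x y z → Q z y x ≡ Q x y z
Q-J-invariant = identity
  where
  identity : ∀ x y z → z * z - + 2 * (y * y) + x * x ≡ x * x - + 2 * (y * y) + z * z
  identity = solve-∀

-- B maps Region⁺ into itself: the new xy is 17xy + 6x² + 12y², and the new
-- y² − z² is the old one plus 4x² + 8y² + 12xy
B-Region⁺ : ∀ {v} → Region⁺ v → Region⁺ (B ▸ v)
B-Region⁺ (region⁺ {x} {y} {z} q xy>0 y²>z²) = subst Region⁺ (sym (B-acts x y z))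
  (region⁺ (trans (Q-B-invariant x y z) q) new-xy>0 new-y²>z²)
  where
  product : ∀ a b → (+ 3 * a + + 4 * b) * (+ 2 * a + + 3 * b)
    ≡ + 17 * (a * b) + (+ 6 * (a * a) + + 12 * (b * b))
  product = solve-∀
  gap : ∀ a b c → (+ 2 * a + + 3 * b) * (+ 2 * a + + 3 * b) - c * c
    ≡ (b * b - c * c) + (+ 4 * (a * a) + (+ 8 * (b * b) + + 12 * (a * b)))
  gap = solve-∀
  new-xy>0 : Pos ((+ 3 * x + + 4 * y) * (+ 2 * x + + 3 * y))
  new-xy>0 = subst Pos (sym (product x y))
    (+-pos-nonNeg (*-pos 17 xy>0)
      (+-nonNeg (*-nonNeg 6 (square-nonNeg x)) (*-nonNeg 12 (square-nonNeg y))))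
  new-y²>z² : Pos ((+ 2 * x + + 3 * y) * (+ 2 * x + + 3 * y) - z * z)
  new-y²>z² = subst Pos (sym (gap x y z))
    (+-pos-nonNeg y²>z²
      (+-nonNeg (*-nonNeg 4 (square-nonNeg x))
        (+-nonNeg (*-nonNeg 8 (square-nonNeg y)) (*-nonNeg 12 (pos⇒nonNeg xy>0)))))

B⁻¹-Region⁻ : ∀ {v} → Region⁻ v → Region⁻ (B⁻¹ ▸ v)
B⁻¹-Region⁻ (region⁻ {x} {y} {z} q xy<0 y²>z²) = subst Region⁻ (sym (B⁻¹-acts x y z))
  (region⁻ (trans (Q-B⁻¹-invariant x y z) q) new-xy<0 new-y²>z²)
  where
  product : ∀ a b → - ((+ 3 * a - + 4 * b) * (+ 3 * b - + 2 * a))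
    ≡ + 17 * (- (a * b)) + (+ 6 * (a * a) + + 12 * (b * b))
  product = solve-∀
  gap : ∀ a b c → (+ 3 * b - + 2 * a) * (+ 3 * b - + 2 * a) - c * c
    ≡ (b * b - c * c) + (+ 4 * (a * a) + (+ 8 * (b * b) + + 12 * (- (a * b))))
  gap = solve-∀
  new-xy<0 : Pos (- ((+ 3 * x - + 4 * y) * (+ 3 * y - + 2 * x)))
  new-xy<0 = subst Pos (sym (product x y))
    (+-pos-nonNeg (*-pos 17 xy<0)
      (+-nonNeg (*-nonNeg 6 (square-nonNeg x)) (*-nonNeg 12 (square-nonNeg y))))
  new-y²>z² : Pos ((+ 3 * y - + 2 * x) * (+ 3 * y - + 2 * x) - z * z)
  new-y²>z² = subst Pos (sym (gap x y z))
    (+-pos-nonNeg y²>z²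
      (+-nonNeg (*-nonNeg 4 (square-nonNeg x))
        (+-nonNeg (*-nonNeg 8 (square-nonNeg y)) (*-nonNeg 12 (pos⇒nonNeg xy<0)))))

-- B maps RegionJ into Region⁺.  Twice the new xy is
-- 5(y² − x²) + 17(x + y)² + 2y², and the new y² − z² equals
-- 6(x + y)² + (y² − x²) − Q, where x + y ≠ 0 because y² − x² ≠ 0.
B-RegionJ : ∀ {v} → RegionJ v → Region⁺ (B ▸ v)
B-RegionJ (regionJ {x} {y} {z} q y²>x²) = subst Region⁺ (sym (B-acts x y z))
  (region⁺ (trans (Q-B-invariant x y z) q) new-xy>0 new-y²>z²)
  where
  doubled-product : ∀ a b → let a′ = + 3 * a + + 4 * b ; b′ = + 2 * a + + 3 * b in
    a′ * b′ + a′ * b′ ≡ + 5 * (b * b - a * a) + (+ 17 * ((a + b) * (a + b)) + + 2 * (b * b))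
  doubled-product = solve-∀
  gap : ∀ a b c → (+ 2 * a + + 3 * b) * (+ 2 * a + + 3 * b) - c * c
    ≡ + 6 * ((a + b) * (a + b)) + ((b * b - a * a) - (a * a - + 2 * (b * b) + c * c))
  gap = solve-∀
  difference-of-squares : ∀ a b → b * b - a * a ≡ (b - a) * (a + b)
  difference-of-squares = solve-∀
  x+y≢0 : x + y ≢ 0ℤ
  x+y≢0 = pos-product⇒≢0 (y - x) (x + y) (subst Pos (difference-of-squares x y) y²>x²)
  new-xy>0 : Pos ((+ 3 * x + + 4 * y) * (+ 2 * x + + 3 * y))
  new-xy>0 = half-pos _ (subst Pos (sym (doubled-product x y))
    (+-pos-nonNeg (*-pos 5 y²>x²)
      (+-nonNeg (*-nonNeg 17 (square-nonNeg (x + y))) (*-nonNeg 2 (square-nonNeg y)))))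
  new-y²>z² : Pos ((+ 2 * x + + 3 * y) * (+ 2 * x + + 3 * y) - z * z)
  new-y²>z² = subst Pos (sym (gap x y z))
    (subst (λ c → Pos (+ 6 * ((x + y) * (x + y)) + ((y * y - x * x) - c))) (sym q)
      (+-pos-nonNeg (*-pos 6 (square-pos x+y≢0)) (pos-pred y²>x²)))

B⁻¹-RegionJ : ∀ {v} → RegionJ v → Region⁻ (B⁻¹ ▸ v)
B⁻¹-RegionJ (regionJ {x} {y} {z} q y²>x²) = subst Region⁻ (sym (B⁻¹-acts x y z))
  (region⁻ (trans (Q-B⁻¹-invariant x y z) q) new-xy<0 new-y²>z²)
  where
  doubled-product : ∀ a b → let a′ = + 3 * a - + 4 * b ; b′ = + 3 * b - + 2 * a in
    - (a′ * b′) + - (a′ * b′) ≡ + 5 * (b * b - a * a) + (+ 17 * ((a - b) * (a - b)) + + 2 * (b * b))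
  doubled-product = solve-∀
  gap : ∀ a b c → (+ 3 * b - + 2 * a) * (+ 3 * b - + 2 * a) - c * c
    ≡ + 6 * ((a - b) * (a - b)) + ((b * b - a * a) - (a * a - + 2 * (b * b) + c * c))
  gap = solve-∀
  difference-of-squares : ∀ a b → b * b - a * a ≡ (- (a + b)) * (a - b)
  difference-of-squares = solve-∀
  x-y≢0 : x - y ≢ 0ℤ
  x-y≢0 = pos-product⇒≢0 (- (x + y)) (x - y) (subst Pos (difference-of-squares x y) y²>x²)
  new-xy<0 : Pos (- ((+ 3 * x - + 4 * y) * (+ 3 * y - + 2 * x)))
  new-xy<0 = half-pos _ (subst Pos (sym (doubled-product x y))
    (+-pos-nonNeg (*-pos 5 y²>x²)
      (+-nonNeg (*-nonNeg 17 (square-nonNeg (x - y))) (*-nonNeg 2 (square-nonNeg y)))))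
  new-y²>z² : Pos ((+ 3 * y - + 2 * x) * (+ 3 * y - + 2 * x) - z * z)
  new-y²>z² = subst Pos (sym (gap x y z))
    (subst (λ c → Pos (+ 6 * ((x - y) * (x - y)) + ((y * y - x * x) - c))) (sym q)
      (+-pos-nonNeg (*-pos 6 (square-pos x-y≢0)) (pos-pred y²>x²)))

J-RegionJ : ∀ x y z → Q x y z ≡ + 1 → Pos (y * y - z * z) → RegionJ (J ▸ vec x y z)
J-RegionJ x y z q y²>z² =
  subst RegionJ (sym (J-acts x y z)) (regionJ (trans (Q-J-invariant x y z) q) y²>z²)

J-Region⁺ : ∀ {v} → Region⁺ v → RegionJ (J ▸ v)
J-Region⁺ (region⁺ {x} {y} {z} q _ y²>z²) = J-RegionJ x y z q y²>z²

J-Region⁻ : ∀ {v} → Region⁻ v → RegionJ (J ▸ v)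
J-Region⁻ (region⁻ {x} {y} {z} q _ y²>z²) = J-RegionJ x y z q y²>z²

B-e₁ : Region⁺ (B ▸ e₁)
B-e₁ = region⁺ refl (5 , refl) (3 , refl)

B⁻¹-e₁ : Region⁻ (B⁻¹ ▸ e₁)
B⁻¹-e₁ = region⁻ refl (5 , refl) (3 , refl)

JWord-RegionJ : ∀ {N} → JWord N → RegionJ (column N)
BWord-Region⁺ : ∀ {N} → BWord N → Region⁺ (column N)
B⁻¹Word-Region⁻ : ∀ {N} → B⁻¹Word N → Region⁻ (column N)

JWord-RegionJ (J-B w) = J-Region⁺ (BWord-Region⁺ w)
JWord-RegionJ (J-B⁻¹ w) = J-Region⁻ (B⁻¹Word-Region⁻ w)

BWord-Region⁺ (B-Jpow n) = subst (λ v → Region⁺ (B ▸ v)) (sym (column-J-Bpow n)) B-e₁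
BWord-Region⁺ (B-J w) = B-RegionJ (JWord-RegionJ w)
BWord-Region⁺ (B-B w) = B-Region⁺ (BWord-Region⁺ w)

B⁻¹Word-Region⁻ (B⁻¹-Jpow n) = subst (λ v → Region⁻ (B⁻¹ ▸ v)) (sym (column-J-Bpow n)) B⁻¹-e₁
B⁻¹Word-Region⁻ (B⁻¹-J w) = B⁻¹-RegionJ (JWord-RegionJ w)
B⁻¹Word-Region⁻ (B⁻¹-B⁻¹ w) = B⁻¹-Region⁻ (B⁻¹Word-Region⁻ w)

lemma7p2 : (M : Mat3) → InH M → entry M (suc zero) (suc (suc zero)) ≡ + 0 →
    (M ≡ I) ⊎ (M ≡ J) ⊎ (∃[ n ] M ≡ Bpow n) ⊎ (∃[ n ] M ≡ J · Bpow n)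
lemma7p2 M h a23≡0 with normal-form h
... | power n = inj₂ (inj₂ (inj₁ (n , refl)))
... | J-power n = inj₂ (inj₂ (inj₂ (n , refl)))
... | j-word w = ⊥-elim (RegionJ-y≢0 (JWord-RegionJ w) a23≡0)
... | b-word w = ⊥-elim (Region⁺-y≢0 (BWord-Region⁺ w) a23≡0)
... | b⁻¹-word w = ⊥-elim (Region⁻-y≢0 (B⁻¹Word-Region⁻ w) a23≡0)
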